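{- Let $M$, $X$, $e$, $f$, $B$, $C$, $A$, $M'$, $C'$, $A'$, $\omega$ be as in the context, and suppose $M'=M[I\,|\,C']$. Let $i,k\in X-e$ be distinct rows and $j,l\in(E-X)-f$ distinct columns such that the submatrices of $A$ and $A'$ with rows $(i,k)$ and columns $(j,l)$ are $\begin{bmatrix}a&0\\0&b\end{bmatrix}$ and $\begin{bmatrix}x&0\\0&y\end{bmatrix}$ respectively, where $a,b,x,y$ are non-zero. Then $a=b$ if and only if $x\neq y$.
   Context: $M$ is a $\mathrm{GF}(4)$-representable matroid on $E$ with a circuit-hyperplane $X$; $e\in X$ and $f\in E-X$ are such that $B=(X-e)\cup f$ is a basis of $M$; and $M=M[I\,|\,C]$ where $C$ is a matrix over $\mathrm{GF}(4)$ with rows indexed by $B$ and columns by $E-B$ of block form $C=\begin{bmatrix}A&\underline1\\ \underline1^T&0\end{bmatrix}$ (rows $X-e$, then $f$; columns $(E-X)-f$, then $e$; $\underline1$ all-ones). $M'$ is the matroid obtained from $M$ by relaxing $X$ (bases $\mathcal{B}(M)\cup\{X\}$), and $C'=\begin{bmatrix}A'&\underline1\\ \underline1^T&\omega\end{bmatrix}$ is a matrix over $\mathrm{GF}(4)$ with the same row and column labels, $A'$ an $(X-e)\times((E-X)-f)$ matrix and $\omega\in\mathrm{GF}(4)-\{0,1\}$. Here $M[I\,|\,C]$ is the vector matroid of $[I\,|\,C]$ with identity columns labelled by the row labels $B$. -}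

module Defs where

open import Data.Nat using (ℕ)
open import Data.Fin using (Fin)
open import Data.Bool using (Bool; true; false)
open import Data.List using (List; _∷_; []; _++_; map; foldr)
open import Data.List using () renaming (allFin to allFinL)
open import Data.Sum using (_⊎_; inj₁; inj₂)
open import Data.Unit using (⊤; tt)
open import Data.Product using (_×_)
open import Relation.Binary.PropositionalEquality using (_≡_)
open import Relation.Nullary using (Dec; yes; no)
open import Data.Fin using (_≟_)

-- The field GF(4) = {0, 1, α, β}, with β = α² = α + 1.

data GF4 : Set where
  0F 1F α β : GF4

infixl 6 _+F_
infixl 7 _*F_

_+F_ : GF4 → GF4 → GF4
0F +F y  = y
x  +F 0F = x
1F +F 1F = 0F
1F +F α  = β
1F +F β  = α
α  +F 1F = β
α  +F α  = 0F
α  +F β  = 1F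
β  +F 1F = α
β  +F α  = 1F
β  +F β  = 0F

_*F_ : GF4 → GF4 → GF4
0F *F y  = 0F
x  *F 0F = 0F
1F *F y  = y
x  *F 1F = x
α  *F α  = β
α  *F β  = 1F
β  *F α  = 1F
β  *F β  = α

-- Ground set E = (X - e) ⊎ {f} ⊎ ((E - X) - f) ⊎ {e},
-- with |X - e| = m and |(E - X) - f| = n.

data El (m n : ℕ) : Set where
  xe  : Fin m → El m n     -- elements of X - e   (row labels of C)
  fE  : El m n             -- the element f       (row label of C)
  yf  : Fin n → El m n     -- elements of (E-X)-f (column labels of C)
  eE  : El m n             -- the element e       (column label of C)

allEl : (m n : ℕ) → List (El m n)
allEl m n = map xe (allFinL m) ++ (fE ∷ map yf (allFinL n)) ++ (eE ∷ [])

-- Row labels of C: B = (X - e) ∪ {f}.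
Row : ℕ → Set
Row m = Fin m ⊎ ⊤

Mat : ℕ → ℕ → Set
Mat m n = Fin m → Fin n → GF4

-- The columns of [I | C_z] where C_z = [[A, 1],[1ᵀ, z]]
-- (z = 0 gives C, z = ω gives C').
colVec : {m n : ℕ} → Mat m n → GF4 → El m n → Row m → GF4
colVec A z (xe r) (inj₁ r') with r ≟ r'
... | yes _ = 1F
... | no  _ = 0F
colVec A z (xe r) (inj₂ _)  = 0F
colVec A z fE     (inj₁ _)  = 0F
colVec A z fE     (inj₂ _)  = 1F
colVec A z (yf c) (inj₁ r)  = A r c
colVec A z (yf c) (inj₂ _)  = 1F
colVec A z eE     (inj₁ _)  = 1F
colVec A z eE     (inj₂ _)  = z

Subset : ℕ → ℕ → Set
Subset m n = El m n → Bool

_⊆_ : {m n : ℕ} → Subset m n → Subset m n → Set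
S ⊆ T = ∀ x → S x ≡ true → T x ≡ true

sumF : List GF4 → GF4
sumF = foldr _+F_ 0F

linComb : {m n : ℕ} → (El m n → Row m → GF4) → (El m n → GF4) → Row m → GF4
linComb {m} {n} v c ρ = sumF (map (λ x → c x *F v x ρ) (allEl m n))

Independent : {m n : ℕ} → (El m n → Row m → GF4) → Subset m n → Set
Independent v S =
  ∀ (c : _ → GF4) → (∀ x → S x ≡ false → c x ≡ 0F)
  → (∀ ρ → linComb v c ρ ≡ 0F) → ∀ x → c x ≡ 0F

IsBasis : {m n : ℕ} → (El m n → Row m → GF4) → Subset m n → Set
IsBasis v S = Independent v S × (∀ T → S ⊆ T → Independent v T → T ⊆ S)

IsBasisM : {m n : ℕ} → Mat m n → GF4 → Subset m n → Set
IsBasisM A z = IsBasis (colVec A z)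

Xset : {m n : ℕ} → Subset m n
Xset (xe _) = true
Xset fE     = false
Xset (yf _) = false
Xset eE     = true

-- For rows R ⊆ X - e and columns K ⊆ (E - X) - f, pivoting on the unit columns of X - R shows that
-- (X - R) ∪ K, which contains e, is a basis of M[I | C_z] exactly when the minor of C_z on the rows
-- R ∪ {f} and the columns K ∪ {e} is nonsingular.  For R = {i, k} and K = {j, l} the minor is
-- [[a, 0, 1], [0, b, 1], [1, 1, z]], with determinant abz + a + b.  Bases of M are bases of M′, and
-- bases of M′ other than X are bases of M.  If a = b the determinant for C is a + b = 0, while x = y
-- would make the one for C′ equal to x²ω ≠ 0.  Conversely, R = {i}, K = {j} gives the minor
-- [[a, 1], [1, 0]] for C, always nonsingular, so [[x, 1], [1, ω]] is nonsingular and xω ≠ 1; likewise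
-- yω ≠ 1.  In GF(4) this and x ≠ y force {x, y} = {1, ω}, where xyω + x + y = ω² + ω + 1 = 0; so the
-- set for {i, k}, {j, l} is not a basis of M′, hence not of M, so a + b = 0, that is, a = b.

module Submission where

open import Defs
open import Data.Bool using (Bool; true; false; not; _∨_; if_then_else_)
open import Data.Bool.Properties using (∨-zeroʳ; ∨-conicalˡ; ∨-conicalʳ)
open import Data.Empty using (⊥-elim)
open import Data.Fin using (Fin; zero; suc; _≟_)
open import Data.Fin.Properties using (suc-injective)
open import Data.List using ([]; _∷_; _++_; map; tabulate; allFin)
open import Data.List.Properties using (map-++; map-cong; map-tabulate)
open import Data.Nat using (ℕ; zero; suc)
open import Data.Product using (_×_; _,_; proj₁; proj₂; ∃-syntax)
open import Data.Sum using (_⊎_; inj₁; inj₂)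
open import Data.Unit using (tt)
open import Function using (_∘_)
open import Function.Bundles using (_⇔_; mk⇔; module Equivalence)
open import Level using (0ℓ)
open import Relation.Binary.Definitions using (DecidableEquality)
open import Relation.Binary.PropositionalEquality
  using (_≡_; _≢_; refl; sym; trans; cong; cong₂; module ≡-Reasoning)
open import Relation.Nullary using (Dec; does; yes; no; ¬_)
open import Relation.Nullary.Decidable
  using (True; toWitness; map′; _×-dec_; _→-dec_; ¬?; dec-true; dec-false; decidable-stable)
open import Relation.Unary using (Pred; Decidable)

open ≡-Reasoning

infix 4 _≟G_
_≟G_ : DecidableEquality GF4
0F ≟G 0F = yes refl
0F ≟G 1F = no λ ()
0F ≟G α  = no λ ()
0F ≟G β  = no λ ()
1F ≟G 0F = no λ ()
1F ≟G 1F = yes refl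
1F ≟G α  = no λ ()
1F ≟G β  = no λ ()
α  ≟G 0F = no λ ()
α  ≟G 1F = no λ ()
α  ≟G α  = yes refl
α  ≟G β  = no λ ()
β  ≟G 0F = no λ ()
β  ≟G 1F = no λ ()
β  ≟G α  = no λ ()
β  ≟G β  = yes refl

∀? : {P : Pred GF4 0ℓ} → Decidable P → Dec (∀ x → P x)
∀? P? = map′ (λ { (p₀ , p₁ , pα , pβ) → λ { 0F → p₀ ; 1F → p₁ ; α → pα ; β → pβ } })
             (λ h → h 0F , h 1F , h α , h β)
             (P? 0F ×-dec P? 1F ×-dec P? α ×-dec P? β)

decide : {A : Set} (a? : Dec A) → {True a?} → A
decide _ {a} = toWitness a

+F-identityʳ : ∀ a → a +F 0F ≡ a
+F-identityʳ = decide (∀? λ _ → _ ≟G _)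

+F-assoc : ∀ a b c → a +F b +F c ≡ a +F (b +F c)
+F-assoc = decide (∀? λ _ → ∀? λ _ → ∀? λ _ → _ ≟G _)

+F-comm : ∀ a b → a +F b ≡ b +F a
+F-comm = decide (∀? λ _ → ∀? λ _ → _ ≟G _)

+F-cancelʳ : ∀ a b → a +F b +F b ≡ a
+F-cancelʳ = decide (∀? λ _ → ∀? λ _ → _ ≟G _)

+F-self : ∀ a → a +F a ≡ 0F
+F-self = decide (∀? λ _ → _ ≟G _)

+F-interchange : ∀ a b c d → a +F b +F (c +F d) ≡ a +F c +F (b +F d)
+F-interchange = decide (∀? λ _ → ∀? λ _ → ∀? λ _ → ∀? λ _ → _ ≟G _)

*F-zeroʳ : ∀ a → a *F 0F ≡ 0F
*F-zeroʳ = decide (∀? λ _ → _ ≟G _)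

*F-identityˡ : ∀ a → 1F *F a ≡ a
*F-identityˡ = decide (∀? λ _ → _ ≟G _)

*F-identityʳ : ∀ a → a *F 1F ≡ a
*F-identityʳ = decide (∀? λ _ → _ ≟G _)

*F-distribʳ : ∀ a b c → (a +F b) *F c ≡ a *F c +F b *F c
*F-distribʳ = decide (∀? λ _ → ∀? λ _ → ∀? λ _ → _ ≟G _)

1F≢0F : 1F ≢ 0F
1F≢0F ()

-- inv 0F = 0F is a junk value.
inv : GF4 → GF4
inv 0F = 0F
inv 1F = 1F
inv α  = β
inv β  = α

det₂ : GF4 → GF4 → GF4
det₂ P z = P *F z +F 1F

det₃ : GF4 → GF4 → GF4 → GF4
det₃ P Q z = P *F Q *F z +F P +F Q

-- The systems with matrices [[P, 1], [1, z]] and [[P, 0, 1], [0, Q, 1], [1, 1, z]] are solved by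
-- Cramer's rule; in characteristic 2 the adjugates carry no signs.
cramer₂ : GF4 → GF4 → GF4 → GF4 → GF4 × GF4
cramer₂ P z w₁ w₂ = d *F (z *F w₁ +F w₂) , d *F (w₁ +F P *F w₂)
  where d = inv (det₂ P z)

cramer₂-solves : ∀ P z w₁ w₂ → det₂ P z ≢ 0F →
  let (p , s) = cramer₂ P z w₁ w₂ in (p *F P +F s ≡ w₁) × (p +F s *F z ≡ w₂)
cramer₂-solves = decide (∀? λ _ → ∀? λ _ → ∀? λ _ → ∀? λ _ →
  ¬? (_ ≟G _) →-dec (_ ≟G _) ×-dec (_ ≟G _))

kernel₂-trivial : ∀ P z p s → det₂ P z ≢ 0F →
  p *F P +F s ≡ 0F → p +F s *F z ≡ 0F → p ≡ 0F × s ≡ 0F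
kernel₂-trivial = decide (∀? λ _ → ∀? λ _ → ∀? λ _ → ∀? λ _ →
  ¬? (_ ≟G _) →-dec (_ ≟G _) →-dec (_ ≟G _) →-dec (_ ≟G _) ×-dec (_ ≟G _))

kernel₂-singular : ∀ P z → det₂ P z ≡ 0F → (1F *F P +F P ≡ 0F) × (1F +F P *F z ≡ 0F)
kernel₂-singular = decide (∀? λ _ → ∀? λ _ → (_ ≟G _) →-dec (_ ≟G _) ×-dec (_ ≟G _))

cramer₃ : GF4 → GF4 → GF4 → GF4 → GF4 → GF4 → GF4 × GF4 × GF4
cramer₃ P Q z w₁ w₂ w₃ =
  d *F ((Q *F z +F 1F) *F w₁ +F w₂ +F Q *F w₃) ,
  d *F (w₁ +F (P *F z +F 1F) *F w₂ +F P *F w₃) ,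
  d *F (Q *F w₁ +F P *F w₂ +F P *F Q *F w₃)
  where d = inv (det₃ P Q z)

cramer₃-solves : ∀ P Q z w₁ w₂ w₃ → det₃ P Q z ≢ 0F →
  let (p , q , s) = cramer₃ P Q z w₁ w₂ w₃
  in (p *F P +F q *F 0F +F s ≡ w₁) × (p *F 0F +F q *F Q +F s ≡ w₂) × (p +F q +F s *F z ≡ w₃)
cramer₃-solves = decide (∀? λ _ → ∀? λ _ → ∀? λ _ → ∀? λ _ → ∀? λ _ → ∀? λ _ →
  ¬? (_ ≟G _) →-dec (_ ≟G _) ×-dec (_ ≟G _) ×-dec (_ ≟G _))

kernel₃-trivial : ∀ P Q z p q s → det₃ P Q z ≢ 0F →
  p *F P +F q *F 0F +F s ≡ 0F → p *F 0F +F q *F Q +F s ≡ 0F → p +F q +F s *F z ≡ 0F →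
  p ≡ 0F × q ≡ 0F × s ≡ 0F
kernel₃-trivial = decide (∀? λ _ → ∀? λ _ → ∀? λ _ → ∀? λ _ → ∀? λ _ → ∀? λ _ →
  ¬? (_ ≟G _) →-dec (_ ≟G _) →-dec (_ ≟G _) →-dec (_ ≟G _) →-dec
  (_ ≟G _) ×-dec (_ ≟G _) ×-dec (_ ≟G _))

kernel₃-singular : ∀ P Q z → det₃ P Q z ≡ 0F →
  (Q *F P +F P *F 0F +F P *F Q ≡ 0F) × (Q *F 0F +F P *F Q +F P *F Q ≡ 0F) × (Q +F P +F P *F Q *F z ≡ 0F)
kernel₃-singular = decide (∀? λ _ → ∀? λ _ → ∀? λ _ →
  (_ ≟G _) →-dec (_ ≟G _) ×-dec (_ ≟G _) ×-dec (_ ≟G _))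

det₂-0F-nonsingular : ∀ P → det₂ P 0F ≢ 0F
det₂-0F-nonsingular = decide (∀? λ _ → ¬? (_ ≟G _))

det₃-0F-singular : ∀ a b → a ≡ b → det₃ a b 0F ≡ 0F
det₃-0F-singular = decide (∀? λ _ → ∀? λ _ → (_ ≟G _) →-dec (_ ≟G _))

det₃-0F-nonsingular : ∀ a b → a ≢ b → det₃ a b 0F ≢ 0F
det₃-0F-nonsingular = decide (∀? λ _ → ∀? λ _ → ¬? (_ ≟G _) →-dec ¬? (_ ≟G _))

det₃-nonsingular-diag : ∀ x y ω → ω ≢ 0F → x ≢ 0F → x ≡ y → det₃ x y ω ≢ 0F
det₃-nonsingular-diag = decide (∀? λ _ → ∀? λ _ → ∀? λ _ →
  ¬? (_ ≟G _) →-dec ¬? (_ ≟G _) →-dec (_ ≟G _) →-dec ¬? (_ ≟G _))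

det₃-singular-offdiag : ∀ x y ω → ω ≢ 0F → ω ≢ 1F → x ≢ 0F → y ≢ 0F →
             det₂ x ω ≢ 0F → det₂ y ω ≢ 0F → x ≢ y → det₃ x y ω ≡ 0F
det₃-singular-offdiag = decide (∀? λ _ → ∀? λ _ → ∀? λ _ →
  ¬? (_ ≟G _) →-dec ¬? (_ ≟G _) →-dec ¬? (_ ≟G _) →-dec ¬? (_ ≟G _) →-dec
  ¬? (_ ≟G _) →-dec ¬? (_ ≟G _) →-dec ¬? (_ ≟G _) →-dec (_ ≟G _))

∑ : {k : ℕ} → (Fin k → GF4) → GF4
∑ f = sumF (tabulate f)

∑-zero : ∀ {k} (f : Fin k → GF4) → (∀ a → f a ≡ 0F) → ∑ f ≡ 0F
∑-zero {zero}  f f≡0 = refl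
∑-zero {suc k} f f≡0 = cong₂ _+F_ (f≡0 zero) (∑-zero (f ∘ suc) (f≡0 ∘ suc))

∑-single : ∀ {k} (f : Fin k → GF4) (r : Fin k) → (∀ a → a ≢ r → f a ≡ 0F) → ∑ f ≡ f r
∑-single f zero    f≡0 = begin
  f zero +F ∑ (f ∘ suc) ≡⟨ cong (f zero +F_) (∑-zero (f ∘ suc) λ a → f≡0 (suc a) λ ()) ⟩
  f zero +F 0F          ≡⟨ +F-identityʳ (f zero) ⟩
  f zero                ∎
∑-single f (suc r) f≡0 =
  cong₂ _+F_ (f≡0 zero λ ()) (∑-single (f ∘ suc) r λ a a≢r → f≡0 (suc a) (a≢r ∘ suc-injective))

∑-pair : ∀ {k} (f : Fin k → GF4) {j l : Fin k} → j ≢ l →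
         (∀ a → a ≢ j → a ≢ l → f a ≡ 0F) → ∑ f ≡ f j +F f l
∑-pair f {zero}  {zero}  j≢l f≡0 = ⊥-elim (j≢l refl)
∑-pair f {zero}  {suc l} j≢l f≡0 =
  cong (f zero +F_) (∑-single (f ∘ suc) l λ a a≢l → f≡0 (suc a) (λ ()) (a≢l ∘ suc-injective))
∑-pair f {suc j} {zero}  j≢l f≡0 = begin
  f zero +F ∑ (f ∘ suc)
    ≡⟨ cong (f zero +F_) (∑-single (f ∘ suc) j λ a a≢j → f≡0 (suc a) (a≢j ∘ suc-injective) (λ ())) ⟩
  f zero +F f (suc j)
    ≡⟨ +F-comm (f zero) (f (suc j)) ⟩
  f (suc j) +F f zero ∎
∑-pair f {suc j} {suc l} j≢l f≡0 =
  cong₂ _+F_ (f≡0 zero (λ ()) (λ ()))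
             (∑-pair (f ∘ suc) (j≢l ∘ cong suc) λ a a≢j a≢l →
                f≡0 (suc a) (a≢j ∘ suc-injective) (a≢l ∘ suc-injective))

∑-cong : ∀ {k} {f g : Fin k → GF4} → (∀ a → f a ≡ g a) → ∑ f ≡ ∑ g
∑-cong {zero}  f≡g = refl
∑-cong {suc k} f≡g = cong₂ _+F_ (f≡g zero) (∑-cong (f≡g ∘ suc))

sumF-++ : ∀ xs ys → sumF (xs ++ ys) ≡ sumF xs +F sumF ys
sumF-++ []       ys = refl
sumF-++ (x ∷ xs) ys = begin
  x +F sumF (xs ++ ys)        ≡⟨ cong (x +F_) (sumF-++ xs ys) ⟩
  x +F (sumF xs +F sumF ys)   ≡⟨ +F-assoc x (sumF xs) (sumF ys) ⟨
  x +F sumF xs +F sumF ys     ∎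

sumF-+ : ∀ {X : Set} (f g : X → GF4) xs →
         sumF (map (λ x → f x +F g x) xs) ≡ sumF (map f xs) +F sumF (map g xs)
sumF-+ f g []       = refl
sumF-+ f g (x ∷ xs) = begin
  f x +F g x +F sumF (map (λ x → f x +F g x) xs)           ≡⟨ cong (f x +F g x +F_) (sumF-+ f g xs) ⟩
  f x +F g x +F (sumF (map f xs) +F sumF (map g xs))        ≡⟨ +F-interchange (f x) (g x) _ _ ⟩
  f x +F sumF (map f xs) +F (g x +F sumF (map g xs))        ∎

sumF-allFin : ∀ {k} {X : Set} (g : X → GF4) (h : Fin k → X) →
              sumF (map g (map h (allFin k))) ≡ ∑ (g ∘ h)
sumF-allFin {k} g h = begin
  sumF (map g (map h (allFin k)))  ≡⟨ cong (sumF ∘ map g) (map-tabulate (λ a → a) h) ⟩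
  sumF (map g (tabulate h))        ≡⟨ cong sumF (map-tabulate h g) ⟩
  ∑ (g ∘ h)                        ∎

true≢false : true ≢ false
true≢false ()

Supported : {X : Set} → (X → Bool) → (X → GF4) → Set
Supported S c = ∀ x → S x ≡ false → c x ≡ 0F

module _ {m n : ℕ} where

  unit : El m n → El m n → GF4
  unit (xe r) (xe a) = if does (a ≟ r) then 1F else 0F
  unit fE     fE     = 1F
  unit (yf c) (yf a) = if does (a ≟ c) then 1F else 0F
  unit eE     eE     = 1F
  unit _      _      = 0F

  xe-injective : ∀ {a b : Fin m} → xe {n = n} a ≡ xe b → a ≡ b
  xe-injective refl = refl

  yf-injective : ∀ {a b : Fin n} → yf {m} a ≡ yf b → a ≡ b
  yf-injective refl = refl

  unit-self : (x : El m n) → unit x x ≡ 1F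
  unit-self (xe r) = cong (if_then 1F else 0F) (dec-true (r ≟ r) refl)
  unit-self fE     = refl
  unit-self (yf c) = cong (if_then 1F else 0F) (dec-true (c ≟ c) refl)
  unit-self eE     = refl

  unit-≢ : ∀ {x y : El m n} → y ≢ x → unit x y ≡ 0F
  unit-≢ {xe r} {xe a} y≢x = cong (if_then 1F else 0F) (dec-false (a ≟ r) (y≢x ∘ cong xe))
  unit-≢ {xe r} {fE}   _   = refl
  unit-≢ {xe r} {yf a} _   = refl
  unit-≢ {xe r} {eE}   _   = refl
  unit-≢ {fE}   {xe a} _   = refl
  unit-≢ {fE}   {fE}   y≢x = ⊥-elim (y≢x refl)
  unit-≢ {fE}   {yf a} _   = refl
  unit-≢ {fE}   {eE}   _   = refl
  unit-≢ {yf c} {xe a} _   = refl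
  unit-≢ {yf c} {fE}   _   = refl
  unit-≢ {yf c} {yf a} y≢x = cong (if_then 1F else 0F) (dec-false (a ≟ c) (y≢x ∘ cong yf))
  unit-≢ {yf c} {eE}   _   = refl
  unit-≢ {eE}   {xe a} _   = refl
  unit-≢ {eE}   {fE}   _   = refl
  unit-≢ {eE}   {yf a} _   = refl
  unit-≢ {eE}   {eE}   y≢x = ⊥-elim (y≢x refl)

  Spans : (El m n → Row m → GF4) → Subset m n → Set
  Spans v S = ∀ (w : Row m → GF4) → ∃[ c ] Supported S c × (∀ ρ → linComb v c ρ ≡ w ρ)

  module _ (v : El m n → Row m → GF4) where

    linComb-split : ∀ c ρ → linComb v c ρ ≡
      ∑ (λ r → c (xe r) *F v (xe r) ρ) +F
        (c fE *F v fE ρ +F (∑ (λ col → c (yf col) *F v (yf col) ρ) +F c eE *F v eE ρ))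
    linComb-split c ρ = begin
      sumF (map g (xs ++ (fE ∷ ys) ++ eE ∷ []))
        ≡⟨ cong sumF (map-++ g xs _) ⟩
      sumF (map g xs ++ map g ((fE ∷ ys) ++ eE ∷ []))
        ≡⟨ sumF-++ (map g xs) _ ⟩
      sumF (map g xs) +F (g fE +F sumF (map g (ys ++ eE ∷ [])))
        ≡⟨ cong₂ (λ a b → a +F (g fE +F b)) (sumF-allFin g xe) (cong sumF (map-++ g ys _)) ⟩
      ∑ (g ∘ xe) +F (g fE +F sumF (map g ys ++ g eE ∷ []))
        ≡⟨ cong (λ b → ∑ (g ∘ xe) +F (g fE +F b)) (sumF-++ (map g ys) _) ⟩
      ∑ (g ∘ xe) +F (g fE +F (sumF (map g ys) +F (g eE +F 0F)))
        ≡⟨ cong₂ (λ a b → ∑ (g ∘ xe) +F (g fE +F (a +F b))) (sumF-allFin g yf) (+F-identityʳ (g eE)) ⟩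
      ∑ (g ∘ xe) +F (g fE +F (∑ (g ∘ yf) +F g eE)) ∎
      where
      g : El m n → GF4
      g x = c x *F v x ρ
      xs = map xe (allFin m)
      ys = map yf (allFin n)

    linComb-+ : ∀ c d ρ → linComb v (λ x → c x +F d x) ρ ≡ linComb v c ρ +F linComb v d ρ
    linComb-+ c d ρ = begin
      sumF (map (λ x → (c x +F d x) *F v x ρ) (allEl m n))
        ≡⟨ cong sumF (map-cong (λ x → *F-distribʳ (c x) (d x) (v x ρ)) (allEl m n)) ⟩
      sumF (map (λ x → c x *F v x ρ +F d x *F v x ρ) (allEl m n))
        ≡⟨ sumF-+ (λ x → c x *F v x ρ) (λ x → d x *F v x ρ) (allEl m n) ⟩
      linComb v c ρ +F linComb v d ρ ∎

    linComb-unit : ∀ x ρ → linComb v (unit x) ρ ≡ v x ρ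
    linComb-unit (xe r) ρ = begin
      linComb v (unit (xe r)) ρ
        ≡⟨ linComb-split (unit (xe r)) ρ ⟩
      ∑ (λ a → unit (xe r) (xe a) *F v (xe a) ρ) +F (0F +F (∑ {n} (λ _ → 0F) +F 0F))
        ≡⟨ cong₂ (λ a b → a +F (b +F 0F))
                 (∑-single _ r λ a a≢r → cong (_*F v (xe a) ρ) (unit-≢ (a≢r ∘ xe-injective)))
                 (∑-zero {n} _ λ _ → refl) ⟩
      unit (xe r) (xe r) *F v (xe r) ρ +F 0F
        ≡⟨ +F-identityʳ _ ⟩
      unit (xe r) (xe r) *F v (xe r) ρ
        ≡⟨ cong (_*F v (xe r) ρ) (unit-self (xe r)) ⟩
      1F *F v (xe r) ρ
        ≡⟨ *F-identityˡ _ ⟩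
      v (xe r) ρ ∎
    linComb-unit fE ρ = begin
      linComb v (unit fE) ρ
        ≡⟨ linComb-split (unit fE) ρ ⟩
      ∑ {m} (λ _ → 0F) +F (1F *F v fE ρ +F (∑ {n} (λ _ → 0F) +F 0F))
        ≡⟨ cong₂ (λ a b → a +F (1F *F v fE ρ +F (b +F 0F)))
                 (∑-zero {m} _ λ _ → refl) (∑-zero {n} _ λ _ → refl) ⟩
      1F *F v fE ρ +F 0F
        ≡⟨ trans (+F-identityʳ _) (*F-identityˡ _) ⟩
      v fE ρ ∎
    linComb-unit (yf c) ρ = begin
      linComb v (unit (yf c)) ρ
        ≡⟨ linComb-split (unit (yf c)) ρ ⟩
      ∑ {m} (λ _ → 0F) +F (0F +F (∑ (λ a → unit (yf c) (yf a) *F v (yf a) ρ) +F 0F))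
        ≡⟨ cong₂ (λ a b → a +F (b +F 0F)) (∑-zero {m} _ λ _ → refl)
                 (∑-single _ c λ a a≢c → cong (_*F v (yf a) ρ) (unit-≢ (a≢c ∘ yf-injective))) ⟩
      unit (yf c) (yf c) *F v (yf c) ρ +F 0F
        ≡⟨ +F-identityʳ _ ⟩
      unit (yf c) (yf c) *F v (yf c) ρ
        ≡⟨ cong (_*F v (yf c) ρ) (unit-self (yf c)) ⟩
      1F *F v (yf c) ρ
        ≡⟨ *F-identityˡ _ ⟩
      v (yf c) ρ ∎
    linComb-unit eE ρ = begin
      linComb v (unit eE) ρ
        ≡⟨ linComb-split (unit eE) ρ ⟩
      ∑ {m} (λ _ → 0F) +F (0F +F (∑ {n} (λ _ → 0F) +F 1F *F v eE ρ))
        ≡⟨ cong₂ (λ a b → a +F (b +F 1F *F v eE ρ))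
                 (∑-zero {m} _ λ _ → refl) (∑-zero {n} _ λ _ → refl) ⟩
      1F *F v eE ρ
        ≡⟨ *F-identityˡ _ ⟩
      v eE ρ ∎

    spanning-independent⇒basis : ∀ {S} → Independent v S → Spans v S → IsBasis v S
    spanning-independent⇒basis {S} S-indep S-spans = S-indep , maximal
      where
      maximal : ∀ T → S ⊆ T → Independent v T → T ⊆ S
      maximal T S⊆T T-indep x Tx with S x in Sx
      ... | true  = refl
      ... | false = ⊥-elim (1F≢0F (begin
        1F             ≡⟨ unit-self x ⟨
        unit x x       ≡⟨ cong (_+F unit x x) (d-supp x Sx) ⟨
        c x            ≡⟨ T-indep c c-supp c-dependence x ⟩
        0F             ∎))
        where
        -- v x is a combination d of S, so d + unit x is a dependence in T (characteristic 2).
        d = proj₁ (S-spans (v x))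
        d-supp = proj₁ (proj₂ (S-spans (v x)))
        d-comb = proj₂ (proj₂ (S-spans (v x)))
        c : El m n → GF4
        c y = d y +F unit x y
        c-supp : Supported T c
        c-supp y Ty =
          cong₂ _+F_ (d-supp y (S∌y y Ty)) (unit-≢ {x} {y} λ { refl → true≢false (trans (sym Tx) Ty) })
          where
          S∌y : ∀ y → T y ≡ false → S y ≡ false
          S∌y y Ty with S y in Sy
          ... | true  = ⊥-elim (true≢false (trans (sym (S⊆T y Sy)) Ty))
          ... | false = refl
        c-dependence : ∀ ρ → linComb v c ρ ≡ 0F
        c-dependence ρ = begin
          linComb v c ρ                           ≡⟨ linComb-+ d (unit x) ρ ⟩
          linComb v d ρ +F linComb v (unit x) ρ   ≡⟨ cong₂ _+F_ (d-comb ρ) (linComb-unit x ρ) ⟩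
          v x ρ +F v x ρ                          ≡⟨ +F-self (v x ρ) ⟩
          0F                                      ∎

⁅_⁆ : ∀ {k} → Fin k → Fin k → Bool
⁅ i ⁆ r = does (r ≟ i)

⁅_⁆∪⁅_⁆ : ∀ {k} → Fin k → Fin k → Fin k → Bool
⁅ i ⁆∪⁅ k ⁆ r = ⁅ i ⁆ r ∨ ⁅ k ⁆ r

⁅⁆-self : ∀ {k} (i : Fin k) → ⁅ i ⁆ i ≡ true
⁅⁆-self i = dec-true (i ≟ i) refl

⁅⁆-sound : ∀ {k} (i r : Fin k) → ⁅ i ⁆ r ≡ true → r ≡ i
⁅⁆-sound i r r∈ with r ≟ i
... | yes r≡i = r≡i

⁅⁆∪⁅⁆-sound : ∀ {k} (i i′ r : Fin k) → ⁅ i ⁆∪⁅ i′ ⁆ r ≡ true → r ≡ i ⊎ r ≡ i′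
⁅⁆∪⁅⁆-sound i i′ r r∈ with r ≟ i | r ≟ i′
... | yes r≡i | _        = inj₁ r≡i
... | no _    | yes r≡i′ = inj₂ r≡i′

∑-⁅⁆ : ∀ {k} {f : Fin k → GF4} {j : Fin k} → Supported ⁅ j ⁆ f → ∑ f ≡ f j
∑-⁅⁆ {f = f} {j} f-supp = ∑-single f j λ a a≢j → f-supp a (dec-false (a ≟ j) a≢j)

∑-⁅⁆∪⁅⁆ : ∀ {k} {f : Fin k → GF4} {j l : Fin k} → j ≢ l → Supported ⁅ j ⁆∪⁅ l ⁆ f → ∑ f ≡ f j +F f l
∑-⁅⁆∪⁅⁆ {f = f} {j} {l} j≢l f-supp =
  ∑-pair f j≢l λ a a≢j a≢l → f-supp a (cong₂ _∨_ (dec-false (a ≟ j) a≢j) (dec-false (a ≟ l) a≢l))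

⁅⁆∪⁅⁆-left : ∀ {k} (i i′ : Fin k) → ⁅ i ⁆∪⁅ i′ ⁆ i ≡ true
⁅⁆∪⁅⁆-left i i′ = cong (_∨ ⁅ i′ ⁆ i) (⁅⁆-self i)

⁅⁆∪⁅⁆-right : ∀ {k} (i i′ : Fin k) → ⁅ i ⁆∪⁅ i′ ⁆ i′ ≡ true
⁅⁆∪⁅⁆-right i i′ = trans (cong (⁅ i ⁆ i′ ∨_) (⁅⁆-self i′)) (∨-zeroʳ (⁅ i ⁆ i′))

⁅⁆-vanishing : ∀ {k} {f : Fin k → GF4} {j : Fin k} → Supported ⁅ j ⁆ f → f j ≡ 0F → ∀ a → f a ≡ 0F
⁅⁆-vanishing {j = j} f-supp fj≡0 a with a ≟ j
... | yes refl = fj≡0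
... | no a≢j   = f-supp a (dec-false (a ≟ j) a≢j)

⁅⁆∪⁅⁆-vanishing : ∀ {k} {f : Fin k → GF4} {j l : Fin k} → Supported ⁅ j ⁆∪⁅ l ⁆ f →
                  f j ≡ 0F → f l ≡ 0F → ∀ a → f a ≡ 0F
⁅⁆∪⁅⁆-vanishing {j = j} {l} f-supp fj≡0 fl≡0 a with a ≟ j | a ≟ l
... | yes refl | _        = fj≡0
... | no _     | yes refl = fl≡0
... | no a≢j   | no a≢l   = f-supp a (cong₂ _∨_ (dec-false (a ≟ j) a≢j) (dec-false (a ≟ l) a≢l))

*F-supported : ∀ {X : Set} {K : X → Bool} {f : X → GF4} (g : X → GF4) →
               Supported K f → Supported K (λ x → f x *F g x)
*F-supported g f-supp x x∉K = cong (_*F g x) (f-supp x x∉K)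

pick : ∀ {k} → Fin k → GF4 → Fin k → GF4
pick j p a = if ⁅ j ⁆ a then p else 0F

pick-self : ∀ {k} (j : Fin k) p → pick j p j ≡ p
pick-self j p = cong (if_then p else 0F) (⁅⁆-self j)

pick-≢ : ∀ {k} {j a : Fin k} p → a ≢ j → pick j p a ≡ 0F
pick-≢ {j = j} {a} p a≢j = cong (if_then p else 0F) (dec-false (a ≟ j) a≢j)

pick-supported : ∀ {k} (j : Fin k) p → Supported ⁅ j ⁆ (pick j p)
pick-supported j p a a∉ = cong (if_then p else 0F) a∉

pick₂ : ∀ {k} → Fin k → Fin k → GF4 → GF4 → Fin k → GF4
pick₂ j l p q a = pick j p a +F pick l q a

pick₂-left : ∀ {k} {j l : Fin k} p q → j ≢ l → pick₂ j l p q j ≡ p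
pick₂-left {j = j} {l} p q j≢l = begin
  pick j p j +F pick l q j   ≡⟨ cong₂ _+F_ (pick-self j p) (pick-≢ q j≢l) ⟩
  p +F 0F                    ≡⟨ +F-identityʳ p ⟩
  p                          ∎

pick₂-right : ∀ {k} {j l : Fin k} p q → j ≢ l → pick₂ j l p q l ≡ q
pick₂-right {j = j} {l} p q j≢l = cong₂ _+F_ (pick-≢ p (j≢l ∘ sym)) (pick-self l q)

pick₂-supported : ∀ {k} (j l : Fin k) p q → Supported ⁅ j ⁆∪⁅ l ⁆ (pick₂ j l p q)
pick₂-supported j l p q a a∉ =
  cong₂ _+F_ (pick-supported j p a (∨-conicalˡ _ _ a∉)) (pick-supported l q a (∨-conicalʳ _ _ a∉))

X∖_∪_ : ∀ {m n} → (Fin m → Bool) → (Fin n → Bool) → Subset m n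
(X∖ R ∪ K) (xe r) = not (R r)
(X∖ R ∪ K) fE     = false
(X∖ R ∪ K) (yf c) = K c
(X∖ R ∪ K) eE     = true

module VectorMatroid {m n : ℕ} (A : Mat m n) (z : GF4) where

  v : El m n → Row m → GF4
  v = colVec A z

  v-xe-self : ∀ r → v (xe r) (inj₁ r) ≡ 1F
  v-xe-self r with r ≟ r
  ... | yes _   = refl
  ... | no r≢r = ⊥-elim (r≢r refl)

  v-xe-≢ : ∀ {a r} → a ≢ r → v (xe a) (inj₁ r) ≡ 0F
  v-xe-≢ {a} {r} a≢r with a ≟ r
  ... | yes a≡r = ⊥-elim (a≢r a≡r)
  ... | no _    = refl

  linComb-row : ∀ c r → linComb v c (inj₁ r) ≡ c (xe r) +F (∑ (λ col → c (yf col) *F A r col) +F c eE)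
  linComb-row c r = begin
    linComb v c (inj₁ r)
      ≡⟨ linComb-split v c (inj₁ r) ⟩
    ∑ (λ a → c (xe a) *F v (xe a) (inj₁ r)) +F (c fE *F 0F +F (Σc +F c eE *F 1F))
      ≡⟨ cong₂ (λ a b → a +F (b +F (Σc +F c eE *F 1F))) xe-part (*F-zeroʳ (c fE)) ⟩
    c (xe r) +F (Σc +F c eE *F 1F)
      ≡⟨ cong (λ b → c (xe r) +F (Σc +F b)) (*F-identityʳ (c eE)) ⟩
    c (xe r) +F (Σc +F c eE) ∎
    where
    Σc = ∑ (λ col → c (yf col) *F A r col)
    xe-part : ∑ (λ a → c (xe a) *F v (xe a) (inj₁ r)) ≡ c (xe r)
    xe-part = begin
      ∑ (λ a → c (xe a) *F v (xe a) (inj₁ r))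
        ≡⟨ ∑-single _ r (λ a a≢r → trans (cong (c (xe a) *F_) (v-xe-≢ a≢r)) (*F-zeroʳ (c (xe a)))) ⟩
      c (xe r) *F v (xe r) (inj₁ r)
        ≡⟨ cong (c (xe r) *F_) (v-xe-self r) ⟩
      c (xe r) *F 1F
        ≡⟨ *F-identityʳ (c (xe r)) ⟩
      c (xe r) ∎

  linComb-frow : ∀ c → linComb v c (inj₂ tt) ≡ c fE +F (∑ (c ∘ yf) +F c eE *F z)
  linComb-frow c = begin
    linComb v c (inj₂ tt)
      ≡⟨ linComb-split v c (inj₂ tt) ⟩
    ∑ (λ a → c (xe a) *F 0F) +F (c fE *F 1F +F (∑ (λ col → c (yf col) *F 1F) +F c eE *F z))
      ≡⟨ cong₂ (λ a b → a +F (b +F (∑ (λ col → c (yf col) *F 1F) +F c eE *F z)))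
               (∑-zero _ (*F-zeroʳ ∘ c ∘ xe)) (*F-identityʳ (c fE)) ⟩
    c fE +F (∑ (λ col → c (yf col) *F 1F) +F c eE *F z)
      ≡⟨ cong (λ b → c fE +F (b +F c eE *F z)) (∑-cong (*F-identityʳ ∘ c ∘ yf)) ⟩
    c fE +F (∑ (c ∘ yf) +F c eE *F z) ∎

  -- Pivoting on the unit columns of X - R: a combination supported on X∖ R ∪ K is determined by
  -- its coefficients cc on K and s on e, which must solve the system given by the minor of C_z on
  -- the rows R ∪ {f} and the columns K ∪ {e}.
  rowValue : (Fin n → GF4) → GF4 → Fin m → GF4
  rowValue cc s r = ∑ (λ col → cc col *F A r col) +F s

  fValue : (Fin n → GF4) → GF4 → GF4
  fValue cc s = ∑ cc +F s *F z

  record SolvesMinor (R : Fin m → Bool) (K : Fin n → Bool)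
                     (cc : Fin n → GF4) (s : GF4) (w : Row m → GF4) : Set where
    field
      supported : Supported K cc
      rows      : ∀ r → R r ≡ true → rowValue cc s r ≡ w (inj₁ r)
      frow      : fValue cc s ≡ w (inj₂ tt)

  open SolvesMinor

  extend : (Fin m → Bool) → (Fin n → GF4) → GF4 → (Row m → GF4) → El m n → GF4
  extend R cc s w (xe r)   = if R r then 0F else w (inj₁ r) +F rowValue cc s r
  extend R cc s w fE       = 0F
  extend R cc s w (yf col) = cc col
  extend R cc s w eE       = s

  module _ {R : Fin m → Bool} {K : Fin n → Bool} where

    extend-supported : ∀ {cc s w} → Supported K cc → Supported (X∖ R ∪ K) (extend R cc s w)
    extend-supported {cc} {s} {w} cc-supp (xe r) r∉ = go
      where
      go : (if R r then 0F else w (inj₁ r) +F rowValue cc s r) ≡ 0F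
      go with R r
      ... | true = refl
    extend-supported cc-supp fE       _   = refl
    extend-supported cc-supp (yf col) col∉ = cc-supp col col∉

    extend-linComb : ∀ {cc s w} → SolvesMinor R K cc s w → ∀ ρ → linComb v (extend R cc s w) ρ ≡ w ρ
    extend-linComb {cc} {s} {w} sol (inj₁ r) = trans (linComb-row (extend R cc s w) r) go
      where
      go : (if R r then 0F else w (inj₁ r) +F rowValue cc s r) +F rowValue cc s r ≡ w (inj₁ r)
      go with R r in r∈R
      ... | true  = rows sol r r∈R
      ... | false = +F-cancelʳ (w (inj₁ r)) (rowValue cc s r)
    extend-linComb {cc} {s} {w} sol (inj₂ tt) = trans (linComb-frow (extend R cc s w)) (frow sol)

    dependence⇒minor-kernel : ∀ {c} → Supported (X∖ R ∪ K) c → (∀ ρ → linComb v c ρ ≡ 0F) →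
                              SolvesMinor R K (c ∘ yf) (c eE) (λ _ → 0F)
    dependence⇒minor-kernel {c} c-supp c-dep = record
      { supported = λ col → c-supp (yf col)
      ; rows      = λ r r∈R → begin
          rowValue (c ∘ yf) (c eE) r
            ≡⟨ cong (_+F rowValue (c ∘ yf) (c eE) r) (c-supp (xe r) (cong not r∈R)) ⟨
          c (xe r) +F rowValue (c ∘ yf) (c eE) r
            ≡⟨ linComb-row c r ⟨
          linComb v c (inj₁ r)
            ≡⟨ c-dep (inj₁ r) ⟩
          0F ∎
      ; frow      = begin
          fValue (c ∘ yf) (c eE)                   ≡⟨ cong (_+F fValue (c ∘ yf) (c eE)) (c-supp fE refl) ⟨
          c fE +F fValue (c ∘ yf) (c eE)           ≡⟨ linComb-frow c ⟨
          linComb v c (inj₂ tt)                    ≡⟨ c-dep (inj₂ tt) ⟩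
          0F                                       ∎
      }

    dependence-vanishing-on-minor : ∀ {c} → (∀ ρ → linComb v c ρ ≡ 0F) →
                                    (∀ col → c (yf col) ≡ 0F) → c eE ≡ 0F → ∀ x → c x ≡ 0F
    dependence-vanishing-on-minor {c} c-dep cK≡0 ce≡0 (xe r) = begin
      c (xe r)
        ≡⟨ +F-identityʳ (c (xe r)) ⟨
      c (xe r) +F 0F
        ≡⟨ cong (c (xe r) +F_) (cong₂ _+F_ (∑-zero _ λ col → cong (_*F A r col) (cK≡0 col)) ce≡0) ⟨
      c (xe r) +F (∑ (λ col → c (yf col) *F A r col) +F c eE)
        ≡⟨ linComb-row c r ⟨
      linComb v c (inj₁ r)
        ≡⟨ c-dep (inj₁ r) ⟩
      0F ∎
    dependence-vanishing-on-minor {c} c-dep cK≡0 ce≡0 fE = begin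
      c fE
        ≡⟨ +F-identityʳ (c fE) ⟨
      c fE +F 0F
        ≡⟨ cong (c fE +F_) (cong₂ _+F_ (∑-zero _ cK≡0) (cong (_*F z) ce≡0)) ⟨
      c fE +F (∑ (c ∘ yf) +F c eE *F z)
        ≡⟨ linComb-frow c ⟨
      linComb v c (inj₂ tt)
        ≡⟨ c-dep (inj₂ tt) ⟩
      0F ∎
    dependence-vanishing-on-minor c-dep cK≡0 ce≡0 (yf col) = cK≡0 col
    dependence-vanishing-on-minor c-dep cK≡0 ce≡0 eE       = ce≡0

    nonsingular-minor⇒basis :
      (∀ w → ∃[ cc ] ∃[ s ] SolvesMinor R K cc s w) →
      (∀ {cc s} → SolvesMinor R K cc s (λ _ → 0F) → (∀ col → cc col ≡ 0F) × s ≡ 0F) →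
      IsBasis v (X∖ R ∪ K)
    nonsingular-minor⇒basis solvable kernel-trivial = spanning-independent⇒basis v independent spans
      where
      independent : Independent v (X∖ R ∪ K)
      independent c c-supp c-dep =
        let (cK≡0 , ce≡0) = kernel-trivial (dependence⇒minor-kernel c-supp c-dep)
        in dependence-vanishing-on-minor c-dep cK≡0 ce≡0
      spans : Spans v (X∖ R ∪ K)
      spans w =
        let (cc , s , sol) = solvable w
        in extend R cc s w , extend-supported (supported sol) , extend-linComb sol

    singular-minor⇒dependent : ∀ {cc s} col → cc col ≢ 0F →
      SolvesMinor R K cc s (λ _ → 0F) → ¬ Independent v (X∖ R ∪ K)
    singular-minor⇒dependent {cc} {s} col cc≢0 sol independent =
      cc≢0 (independent (extend R cc s (λ _ → 0F)) (extend-supported (supported sol)) (extend-linComb sol)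
                        (yf col))

  module _ {j : Fin n} where

    rowValue-⁅⁆ : ∀ {cc s} r → Supported ⁅ j ⁆ cc → rowValue cc s r ≡ cc j *F A r j +F s
    rowValue-⁅⁆ {s = s} r cc-supp = cong (_+F s) (∑-⁅⁆ (*F-supported (A r) cc-supp))

    fValue-⁅⁆ : ∀ {cc s} → Supported ⁅ j ⁆ cc → fValue cc s ≡ cc j +F s *F z
    fValue-⁅⁆ {s = s} cc-supp = cong (_+F s *F z) (∑-⁅⁆ cc-supp)

  module _ {j l : Fin n} (j≢l : j ≢ l) where

    rowValue-⁅⁆∪⁅⁆ : ∀ {cc s} r → Supported ⁅ j ⁆∪⁅ l ⁆ cc →
                     rowValue cc s r ≡ cc j *F A r j +F cc l *F A r l +F s
    rowValue-⁅⁆∪⁅⁆ {s = s} r cc-supp = cong (_+F s) (∑-⁅⁆∪⁅⁆ j≢l (*F-supported (A r) cc-supp))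

    fValue-⁅⁆∪⁅⁆ : ∀ {cc s} → Supported ⁅ j ⁆∪⁅ l ⁆ cc → fValue cc s ≡ cc j +F cc l +F s *F z
    fValue-⁅⁆∪⁅⁆ {s = s} cc-supp = cong (_+F s *F z) (∑-⁅⁆∪⁅⁆ j≢l cc-supp)

  module _ (i : Fin m) (j : Fin n) where

    basis-single : det₂ (A i j) z ≢ 0F → IsBasis v (X∖ ⁅ i ⁆ ∪ ⁅ j ⁆)
    basis-single d≢0 = nonsingular-minor⇒basis solvable kernel-trivial
      where
      solvable : ∀ w → ∃[ cc ] ∃[ s ] SolvesMinor ⁅ i ⁆ ⁅ j ⁆ cc s w
      solvable w = pick j p , s , record
        { supported = pick-supported j p
        ; rows      = row-equations
        ; frow      = begin
            fValue (pick j p) s      ≡⟨ fValue-⁅⁆ {s = s} (pick-supported j p) ⟩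
            pick j p j +F s *F z     ≡⟨ cong (_+F s *F z) (pick-self j p) ⟩
            p +F s *F z              ≡⟨ proj₂ solves ⟩
            w (inj₂ tt)              ∎
        }
        where
        p = proj₁ (cramer₂ (A i j) z (w (inj₁ i)) (w (inj₂ tt)))
        s = proj₂ (cramer₂ (A i j) z (w (inj₁ i)) (w (inj₂ tt)))
        solves = cramer₂-solves (A i j) z (w (inj₁ i)) (w (inj₂ tt)) d≢0
        row-equations : ∀ r → ⁅ i ⁆ r ≡ true → rowValue (pick j p) s r ≡ w (inj₁ r)
        row-equations r r∈ with refl ← ⁅⁆-sound i r r∈ = begin
          rowValue (pick j p) s r      ≡⟨ rowValue-⁅⁆ r (pick-supported j p) ⟩
          pick j p j *F A r j +F s     ≡⟨ cong (λ t → t *F A r j +F s) (pick-self j p) ⟩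
          p *F A r j +F s              ≡⟨ proj₁ solves ⟩
          w (inj₁ r)                   ∎
      kernel-trivial : ∀ {cc s} → SolvesMinor ⁅ i ⁆ ⁅ j ⁆ cc s (λ _ → 0F) → (∀ col → cc col ≡ 0F) × s ≡ 0F
      kernel-trivial {cc} {s} sol =
        let (cj≡0 , s≡0) = kernel₂-trivial (A i j) z (cc j) s d≢0
              (trans (sym (rowValue-⁅⁆ i (supported sol))) (rows sol i (⁅⁆-self i)))
              (trans (sym (fValue-⁅⁆ {s = s} (supported sol))) (frow sol))
        in ⁅⁆-vanishing (supported sol) cj≡0 , s≡0

    dependent-single : det₂ (A i j) z ≡ 0F → ¬ Independent v (X∖ ⁅ i ⁆ ∪ ⁅ j ⁆)
    dependent-single d≡0 = singular-minor⇒dependent j (1F≢0F ∘ trans (sym (pick-self j 1F))) sol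
      where
      -- the kernel vector (1, A i j) of [[A i j, 1], [1, z]]
      cc = pick j 1F
      sol : SolvesMinor ⁅ i ⁆ ⁅ j ⁆ cc (A i j) (λ _ → 0F)
      sol = record
        { supported = pick-supported j 1F
        ; rows      = row-equations
        ; frow      = begin
            fValue cc (A i j)          ≡⟨ fValue-⁅⁆ {s = A i j} (pick-supported j 1F) ⟩
            cc j +F A i j *F z         ≡⟨ cong (_+F A i j *F z) (pick-self j 1F) ⟩
            1F +F A i j *F z           ≡⟨ proj₂ (kernel₂-singular (A i j) z d≡0) ⟩
            0F                         ∎
        }
        where
        row-equations : ∀ r → ⁅ i ⁆ r ≡ true → rowValue cc (A i j) r ≡ 0F
        row-equations r r∈ with refl ← ⁅⁆-sound i r r∈ = begin
          rowValue cc (A r j) r        ≡⟨ rowValue-⁅⁆ r (pick-supported j 1F) ⟩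
          cc j *F A r j +F A r j       ≡⟨ cong (λ t → t *F A r j +F A r j) (pick-self j 1F) ⟩
          1F *F A r j +F A r j         ≡⟨ proj₁ (kernel₂-singular (A r j) z d≡0) ⟩
          0F                           ∎

  module _ {i k : Fin m} {j l : Fin n} (j≢l : j ≢ l) (Ail≡0 : A i l ≡ 0F) (Akj≡0 : A k j ≡ 0F) where

    private
      P = A i j
      Q = A k l

      rowValue-i : ∀ {cc s} → Supported ⁅ j ⁆∪⁅ l ⁆ cc → rowValue cc s i ≡ cc j *F P +F cc l *F 0F +F s
      rowValue-i {cc} {s} cc-supp =
        trans (rowValue-⁅⁆∪⁅⁆ j≢l i cc-supp) (cong (λ t → cc j *F P +F cc l *F t +F s) Ail≡0)

      rowValue-k : ∀ {cc s} → Supported ⁅ j ⁆∪⁅ l ⁆ cc → rowValue cc s k ≡ cc j *F 0F +F cc l *F Q +F s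
      rowValue-k {cc} {s} cc-supp =
        trans (rowValue-⁅⁆∪⁅⁆ j≢l k cc-supp) (cong (λ t → cc j *F t +F cc l *F Q +F s) Akj≡0)

    basis-pair : det₃ P Q z ≢ 0F → IsBasis v (X∖ ⁅ i ⁆∪⁅ k ⁆ ∪ ⁅ j ⁆∪⁅ l ⁆)
    basis-pair d≢0 = nonsingular-minor⇒basis solvable kernel-trivial
      where
      solvable : ∀ w → ∃[ cc ] ∃[ s ] SolvesMinor ⁅ i ⁆∪⁅ k ⁆ ⁅ j ⁆∪⁅ l ⁆ cc s w
      solvable w = cc , s , record
        { supported = pick₂-supported j l p q
        ; rows      = row-equations
        ; frow      = begin
            fValue cc s
              ≡⟨ fValue-⁅⁆∪⁅⁆ j≢l {s = s} (pick₂-supported j l p q) ⟩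
            cc j +F cc l +F s *F z
              ≡⟨ cong₂ (λ a b → a +F b +F s *F z) (pick₂-left p q j≢l) (pick₂-right p q j≢l) ⟩
            p +F q +F s *F z
              ≡⟨ proj₂ (proj₂ solves) ⟩
            w (inj₂ tt) ∎
        }
        where
        solution = cramer₃ P Q z (w (inj₁ i)) (w (inj₁ k)) (w (inj₂ tt))
        p = proj₁ solution
        q = proj₁ (proj₂ solution)
        s = proj₂ (proj₂ solution)
        solves = cramer₃-solves P Q z (w (inj₁ i)) (w (inj₁ k)) (w (inj₂ tt)) d≢0
        cc = pick₂ j l p q
        cc-values : ∀ a b → cc j *F a +F cc l *F b +F s ≡ p *F a +F q *F b +F s
        cc-values a b = cong₂ (λ x y → x *F a +F y *F b +F s) (pick₂-left p q j≢l) (pick₂-right p q j≢l)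
        row-equations : ∀ r → ⁅ i ⁆∪⁅ k ⁆ r ≡ true → rowValue cc s r ≡ w (inj₁ r)
        row-equations r r∈ with ⁅⁆∪⁅⁆-sound i k r r∈
        ... | inj₁ refl =
          trans (rowValue-i (pick₂-supported j l p q)) (trans (cc-values P 0F) (proj₁ solves))
        ... | inj₂ refl =
          trans (rowValue-k (pick₂-supported j l p q)) (trans (cc-values 0F Q) (proj₁ (proj₂ solves)))
      kernel-trivial : ∀ {cc s} → SolvesMinor ⁅ i ⁆∪⁅ k ⁆ ⁅ j ⁆∪⁅ l ⁆ cc s (λ _ → 0F) →
                       (∀ col → cc col ≡ 0F) × s ≡ 0F
      kernel-trivial {cc} {s} sol =
        let (cj≡0 , cl≡0 , s≡0) = kernel₃-trivial P Q z (cc j) (cc l) s d≢0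
              (trans (sym (rowValue-i (supported sol))) (rows sol i (⁅⁆∪⁅⁆-left i k)))
              (trans (sym (rowValue-k (supported sol))) (rows sol k (⁅⁆∪⁅⁆-right i k)))
              (trans (sym (fValue-⁅⁆∪⁅⁆ j≢l {s = s} (supported sol))) (frow sol))
        in ⁅⁆∪⁅⁆-vanishing (supported sol) cj≡0 cl≡0 , s≡0

    dependent-pair : Q ≢ 0F → det₃ P Q z ≡ 0F → ¬ Independent v (X∖ ⁅ i ⁆∪⁅ k ⁆ ∪ ⁅ j ⁆∪⁅ l ⁆)
    dependent-pair Q≢0 d≡0 = singular-minor⇒dependent j (Q≢0 ∘ trans (sym (pick₂-left Q P j≢l))) sol
      where
      -- the kernel vector (Q, P, P Q) of [[P, 0, 1], [0, Q, 1], [1, 1, z]]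
      cc = pick₂ j l Q P
      s = P *F Q
      cc-values : ∀ a b → cc j *F a +F cc l *F b +F s ≡ Q *F a +F P *F b +F s
      cc-values a b = cong₂ (λ x y → x *F a +F y *F b +F s) (pick₂-left Q P j≢l) (pick₂-right Q P j≢l)
      singular = kernel₃-singular P Q z d≡0
      row-equations : ∀ r → ⁅ i ⁆∪⁅ k ⁆ r ≡ true → rowValue cc s r ≡ 0F
      row-equations r r∈ with ⁅⁆∪⁅⁆-sound i k r r∈
      ... | inj₁ refl =
        trans (rowValue-i (pick₂-supported j l Q P)) (trans (cc-values P 0F) (proj₁ singular))
      ... | inj₂ refl =
        trans (rowValue-k (pick₂-supported j l Q P)) (trans (cc-values 0F Q) (proj₁ (proj₂ singular)))
      sol : SolvesMinor ⁅ i ⁆∪⁅ k ⁆ ⁅ j ⁆∪⁅ l ⁆ cc s (λ _ → 0F)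
      sol = record
        { supported = pick₂-supported j l Q P
        ; rows      = row-equations
        ; frow      = begin
            fValue cc s
              ≡⟨ fValue-⁅⁆∪⁅⁆ j≢l {s = s} (pick₂-supported j l Q P) ⟩
            cc j +F cc l +F s *F z
              ≡⟨ cong₂ (λ a b → a +F b +F s *F z) (pick₂-left Q P j≢l) (pick₂-right Q P j≢l) ⟩
            Q +F P +F s *F z
              ≡⟨ proj₂ (proj₂ singular) ⟩
            0F ∎
        }

lemma6p4 : (m n : ℕ) (A A′ : Mat m n) (ω : GF4)
    → ω ≢ 0F → ω ≢ 1F
    → (∀ (S : Subset m n) → IsBasisM A′ ω S ⇔ (IsBasisM A 0F S ⊎ (∀ x → S x ≡ Xset x)))
    → (i k : Fin m) (j l : Fin n) → i ≢ k → j ≢ l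
    → A i l ≡ 0F → A k j ≡ 0F → A′ i l ≡ 0F → A′ k j ≡ 0F
    → A i j ≢ 0F → A k l ≢ 0F → A′ i j ≢ 0F → A′ k l ≢ 0F
    → (A i j ≡ A k l) ⇔ (A′ i j ≢ A′ k l)
lemma6p4 m n A A′ ω ω≢0 ω≢1 relaxation i k j l _ j≢l Ail≡0 Akj≡0 A′il≡0 A′kj≡0 _ b≢0 x≢0 y≢0 =
  mk⇔ a≡b⇒x≢y x≢y⇒a≡b
  where
  -- i ≢ k is implied by A′ k j ≡ 0F and A′ i j ≢ 0F.
  module M  = VectorMatroid A 0F
  module M′ = VectorMatroid A′ ω
  S = X∖ ⁅ i ⁆∪⁅ k ⁆ ∪ ⁅ j ⁆∪⁅ l ⁆

  M⇒M′ : ∀ {T} → IsBasisM A 0F T → IsBasisM A′ ω T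
  M⇒M′ {T} = Equivalence.from (relaxation T) ∘ inj₁

  S-M′⇒M : IsBasisM A′ ω S → IsBasisM A 0F S
  S-M′⇒M S-basis with Equivalence.to (relaxation S) S-basis
  ... | inj₁ S-basis′ = S-basis′
  ... | inj₂ S≡X      = ⊥-elim (true≢false (trans (sym (⁅⁆∪⁅⁆-left j l)) (S≡X (yf j))))

  det₂-A′-nonsingular : ∀ r c → det₂ (A′ r c) ω ≢ 0F
  det₂-A′-nonsingular r c d≡0 =
    M′.dependent-single r c d≡0 (proj₁ (M⇒M′ (M.basis-single r c (det₂-0F-nonsingular (A r c)))))

  a≡b⇒x≢y : A i j ≡ A k l → A′ i j ≢ A′ k l
  a≡b⇒x≢y a≡b x≡y =
    M.dependent-pair j≢l Ail≡0 Akj≡0 b≢0 (det₃-0F-singular _ _ a≡b)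
      (proj₁ (S-M′⇒M (M′.basis-pair j≢l A′il≡0 A′kj≡0 (det₃-nonsingular-diag _ _ ω ω≢0 x≢0 x≡y))))

  x≢y⇒a≡b : A′ i j ≢ A′ k l → A i j ≡ A k l
  x≢y⇒a≡b x≢y = decidable-stable (A i j ≟G A k l) λ a≢b →
    M′.dependent-pair j≢l A′il≡0 A′kj≡0 y≢0 (det₃-singular-offdiag _ _ ω ω≢0 ω≢1 x≢0 y≢0
                                               (det₂-A′-nonsingular i j) (det₂-A′-nonsingular k l) x≢y)
      (proj₁ (M⇒M′ (M.basis-pair j≢l Ail≡0 Akj≡0 (det₃-0F-nonsingular _ _ a≢b))))
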